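{- Let $k\geq1$, let $G_i=(V_i,E_i)$ ($1\le i\le k$) and $H=(V_H,E_H)$ be pairwise vertex-disjoint, connected graphs, each with at least two vertices, let $u_i\in V_i$ and $v_1,\dots,v_k\in V_H$ (not necessarily distinct), and let $J=G_{1,\ldots,k}\circ^{u_1,\dots,u_k}_{v_1,\dots,v_k}H$. Define $$U_0=\mathrm{MVC}\bigl(\mathrm{SR}(H)\setminus\{v_1,\dots,v_k\}\bigr)\cup\bigcup_{1\le i\le k}\mathrm{XVC}\bigl(\mathrm{SR}(G_i)\setminus\{u_i\},\ \mathrm{MD}_{G_i}(u_i)\bigr)$$ and, for $j=1,\dots,k$, $$U_j=\mathrm{XVC}\bigl(\mathrm{SR}(H)\setminus\{v_1,\dots,v_k\},\ \mathrm{MD}_H(v_j)\setminus\{v_1,\dots,v_k\}\bigr)\cup\mathrm{MVC}\bigl(\mathrm{SR}(G_j)\setminus\{u_j\}\bigr)\cup\bigcup_{1\le i\le k,\ i\ne j}\mathrm{XVC}\bigl(\mathrm{SR}(G_i)\setminus\{u_i\},\ \mathrm{MD}_{G_i}(u_i)\bigr),$$ where each $\mathrm{MVC}(\cdot)$ and $\mathrm{XVC}(\cdot,\cdot)$ denotes an arbitrary set with the defining property. Then each of $U_0,U_1,\dots,U_k$ is a vertex cover of $\mathrm{SR}(J)$, and at least one of them is a minimum vertex cover of $\mathrm{SR}(J)$.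
   Context: All graphs are finite, undirected and simple. In a connected graph $G$, $d_G(x,y)$ is the distance and $N_G(x)$ the set of neighbours of $x$. A vertex $u$ is maximally distant from $w$ in $G$ if there is no $v\in N_G(u)$ with $d_G(v,w)>d_G(u,w)$; $\mathrm{MD}_G(u)$ is the set of vertices maximally distant from $u$ in $G$; two vertices are mutually maximally distant if each is maximally distant from the other. The strong resolving graph $\mathrm{SR}(G)$ has the vertex set of $G$, with an edge between distinct $u,v$ iff they are mutually maximally distant in $G$. For a graph $F$ and vertex set $X$, $F\setminus X$ denotes $F$ with the vertices of $X$ and their incident edges deleted. $\mathrm{MVC}(F)$ denotes a minimum-cardinality vertex cover of $F$; for a vertex set $M$ of $F$, $\mathrm{XVC}(F,M)$ denotes a vertex cover of $F$ that contains $M$ and has minimum cardinality among all vertex covers of $F$ containing $M$. The composed graph $J=G_{1,\ldots,k}\circ^{u_1,\dots,u_k}_{v_1,\dots,v_k}H$ has vertex set $(V_1\cup\dots\cup V_k\cup V_H)\setminus\{u_1,\dots,u_k\}$ and edge set $(E_1\cup\dots\cup E_k\cup E_H\cup\{\{x,v_i\}: x\in N_{G_i}(u_i),1\le i\le k\})\setminus\{\{x,u_i\}: x\in N_{G_i}(u_i),1\le i\le k\}$; i.e. $J$ is obtained by identifying each $u_i$ with $v_i$. -}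

module Defs where

open import Data.Nat using (ℕ; zero; suc; _≤_)
open import Data.Fin using (Fin)
open import Data.List using (List; length)
open import Data.List.Membership.Propositional using (_∈_)
open import Data.List.Relation.Unary.Unique.Propositional using (Unique)
open import Data.Product using (Σ; ∃; _×_; _,_)
open import Data.Sum using (_⊎_)
open import Relation.Nullary using (¬_; Dec)
open import Relation.Binary.PropositionalEquality using (_≡_; _≢_)
open import Relation.Binary.Definitions using (DecidableEquality)
open import Level using (0ℓ) renaming (suc to lsuc)

-- A graph whose vertices live in an ambient universe U:
-- a vertex set (predicate on U) and an adjacency relation on U
-- (edge {x,y} is represented by E x y and E y x).
record Graph (U : Set) : Set₁ where
  field
    V : U → Set
    E : U → U → Set
open Graph public

module _ {U : Set} where

  record IsFiniteSimpleGraph (G : Graph U) : Set where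
    field
      V-dec    : ∀ x → Dec (V G x)
      E-dec    : ∀ x y → Dec (E G x y)
      finite   : Σ (List U) λ xs → ∀ x → V G x → x ∈ xs
      E-in-V   : ∀ x y → E G x y → V G x × V G y
      E-sym    : ∀ x y → E G x y → E G y x
      E-irrefl : ∀ x → ¬ E G x x

  data Walk (G : Graph U) : U → U → ℕ → Set where
    [] : ∀ {x} → V G x → Walk G x x zero
    _∷_ : ∀ {x z y n} → E G x z → Walk G z y n → Walk G x y (suc n)

  Connected : Graph U → Set
  Connected G = ∀ x y → V G x → V G y → ∃ λ n → Walk G x y n

  AtLeastTwoVertices : Graph U → Set
  AtLeastTwoVertices G = Σ U λ x → Σ U λ y → V G x × V G y × x ≢ y

  Dist : Graph U → U → U → ℕ → Set
  Dist G x y d = Walk G x y d × (∀ m → Walk G x y m → d ≤ m)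

  MaxDistFrom : Graph U → U → U → Set
  MaxDistFrom G u w =
    V G u × (∀ v → E G u v → ∀ dv du → Dist G v w dv → Dist G u w du → dv ≤ du)

  MD : Graph U → U → U → Set
  MD G w u = MaxDistFrom G u w

  MutuallyMaxDist : Graph U → U → U → Set
  MutuallyMaxDist G u v = MaxDistFrom G u v × MaxDistFrom G v u

  SR : Graph U → Graph U
  SR G = record { V = V G ; E = λ x y → x ≢ y × MutuallyMaxDist G x y }

  _∖_ : Graph U → (U → Set) → Graph U
  F ∖ X = record { V = λ x → V F x × ¬ X x
                 ; E = λ x y → E F x y × ¬ X x × ¬ X y }

  HasSize : (U → Set) → ℕ → Set
  HasSize S n = Σ (List U) λ xs →
    Unique xs × (∀ x → x ∈ xs → S x) × (∀ x → S x → x ∈ xs) × length xs ≡ n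

  _⊆_ : (U → Set) → (U → Set) → Set
  A ⊆ B = ∀ x → A x → B x

  IsVC : Graph U → (U → Set) → Set
  IsVC F S = S ⊆ V F × (∀ x y → E F x y → S x ⊎ S y)

  IsMVC : Graph U → (U → Set) → Set₁
  IsMVC F S = IsVC F S × Σ ℕ λ n → HasSize S n ×
    (∀ (S' : U → Set) m → IsVC F S' → HasSize S' m → n ≤ m)

  IsXVC : Graph U → (U → Set) → (U → Set) → Set₁
  IsXVC F M S = IsVC F S × M ⊆ S × Σ ℕ λ n → HasSize S n ×
    (∀ (S' : U → Set) m → IsVC F S' → M ⊆ S' → HasSize S' m → n ≤ m)

  compose : (k : ℕ) → (Fin k → Graph U) → Graph U → (Fin k → U) → (Fin k → U) → Graph U
  compose k G H u v = record
    { V = λ x → ((Σ (Fin k) λ i → V (G i) x) ⊎ V H x) × (∀ i → x ≢ u i)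
    ; E = λ x y → (Base x y ⊎ New x y) × ¬ Removed x y }
    where
    Base : U → U → Set
    Base x y = (Σ (Fin k) λ i → E (G i) x y) ⊎ E H x y
    New : U → U → Set
    New x y = Σ (Fin k) λ i → (E (G i) x (u i) × y ≡ v i) ⊎ (E (G i) y (u i) × x ≡ v i)
    Removed : U → U → Set
    Removed x y = Σ (Fin k) λ i → (E (G i) x (u i) × y ≡ u i) ⊎ (E (G i) y (u i) × x ≡ u i)

module Submission where

open import Defs
open import Data.Nat using (ℕ; zero; suc; _+_; _≤_; z≤n; s≤s; _≤?_; +-0-rawMonoid)
open import Data.Nat.Properties
  using (≤-refl; ≤-trans; ≤-antisym; <⇒≤; ≰⇒>; 1+n≰n; m≤n⇒m≤1+n; +-mono-≤; +-monoʳ-≤; +-cancelˡ-≤;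
         +-suc; +-comm; +-identityʳ; module ≤-Reasoning)
open import Data.Fin using (Fin; zero; suc) renaming (_≟_ to _≟ᶠ_)
open import Data.Fin.Properties using (all?; ¬∀⟶∃¬; 0≢1+n) renaming (any? to anyᶠ?; suc-injective to suc-injectiveᶠ)
open import Data.List using (List; []; _∷_; _++_; length; filter)
open import Data.List.Properties using (length-++)
open import Data.List.Membership.Propositional using (_∈_)
open import Data.List.Membership.Propositional.Properties using (∈-++⁺ˡ; ∈-++⁺ʳ; ∈-++⁻; ∈-∃++; ∈-filter⁺; ∈-filter⁻)
open import Data.List.Relation.Unary.Any as Any using (here; there; any?)
open import Data.List.Relation.Unary.All as All using ()
open import Data.List.Relation.Unary.AllPairs using ([]; _∷_)
open import Data.List.Relation.Unary.Unique.Propositional using (Unique)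
import Data.List.Relation.Unary.Unique.Propositional.Properties as Unique
open import Data.Product using (Σ; _×_; _,_; proj₁; proj₂)
open import Data.Sum using (_⊎_; inj₁; inj₂; [_,_]) renaming (map to ⊎-map; swap to ⊎-swap)
open import Data.Empty using (⊥)
open import Function using (_∘_; id)
open import Algebra.Definitions.RawMonoid +-0-rawMonoid using (sum)
open import Relation.Nullary using (¬_; Dec; yes; no; contradiction)
open import Relation.Nullary.Decidable using (map′; _×-dec_; ¬?)
open import Relation.Unary using (Pred; Decidable; _∪_; _∩_; ⋃)
open import Relation.Binary.PropositionalEquality using (_≡_; _≢_; refl; sym; cong; subst; subst₂)
open import Relation.Binary.Definitions using (DecidableEquality)
open import Level using (0ℓ)

-- Every path between the pieces of J passes through a glue vertex u i ~ v i, so distances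
-- inside a piece are unchanged, and distances from G i to the outside are those to u i
-- shifted by a constant. Hence a vertex x of G i other than u i is maximally distant from
-- some y outside G i iff x ∈ MD(u i) (dually for H and v j), and the glue vertices are never
-- maximally distant. So SR(J) consists of SR(H) ∖ {v} and the SR(G i) ∖ {u i}, joined by
-- edges that each have an end in some MD(u i); U₀ and every Uⱼ cover these. A cover S of SR(J)
-- splits into covers of the pieces: if S contains every MD(u i) it is no smaller than U₀;
-- if it misses a vertex of MD(u j), it contains all SR-neighbours of that vertex, namely
-- MD(v j) ∖ {v} and the MD(u i) for i ≢ j, and is no smaller than Uⱼ.

least : {P : ℕ → Set} → (∀ m → Dec (P m)) → ∀ n → P n → Σ ℕ λ d → P d × (∀ m → P m → d ≤ m)
least P? zero p = zero , p , λ _ _ → z≤n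
least P? (suc n) p with P? zero
... | yes p₀ = zero , p₀ , λ _ _ → z≤n
... | no ¬p₀ with least (P? ∘ suc) n p
...   | d , pd , min = suc d , pd , λ { zero p₀ → contradiction p₀ ¬p₀ ; (suc m) pm → s≤s (min m pm) }

argmin : ∀ {k} (f : Fin (suc k) → ℕ) → Σ (Fin (suc k)) λ i → ∀ j → f i ≤ f j
argmin {zero} f = zero , λ { zero → ≤-refl }
argmin {suc k} f with argmin (f ∘ suc)
... | i , min with f zero ≤? f (suc i)
...   | yes f₀≤ = zero , λ { zero → ≤-refl ; (suc j) → ≤-trans f₀≤ (min j) }
...   | no f₀≰ = suc i , λ { zero → <⇒≤ (≰⇒> f₀≰) ; (suc j) → min j }

sum-mono-≤ : ∀ {k} {f g : Fin k → ℕ} → (∀ i → f i ≤ g i) → sum f ≤ sum g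
sum-mono-≤ {zero} _ = z≤n
sum-mono-≤ {suc k} f≤g = +-mono-≤ (f≤g zero) (sum-mono-≤ (f≤g ∘ suc))

module _ {U : Set} where

  walk-++ : ∀ {F : Graph U} {x y z m n} → Walk F x y m → Walk F y z n → Walk F x z (m + n)
  walk-++ ([] _) w = w
  walk-++ (e ∷ w) w′ = e ∷ walk-++ w w′

  walk₀-≡ : ∀ {F : Graph U} {x y} → Walk F x y 0 → x ≡ y
  walk₀-≡ ([] _) = refl

  walk-snoc : ∀ {F : Graph U} {x y z n} → Walk F x y n → E F y z → V F z → Walk F x z (suc n)
  walk-snoc ([] _) e z∈F = e ∷ [] z∈F
  walk-snoc (e′ ∷ w) e z∈F = e′ ∷ walk-snoc w e z∈F

  first-step : ∀ {F : Graph U} {x y n} → Walk F x y n → x ≢ y → Σ U (E F x)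
  first-step ([] _) x≢y = contradiction refl x≢y
  first-step (e ∷ _) _ = _ , e

  dist-unique : ∀ {F : Graph U} {x y d d′} → Dist F x y d → Dist F x y d′ → d ≡ d′
  dist-unique (w , min) (w′ , min′) = ≤-antisym (min _ w′) (min′ _ w)

  dist-refl : ∀ {F : Graph U} {x} → V F x → Dist F x x 0
  dist-refl x∈F = [] x∈F , λ _ _ → z≤n

  dist-edge : ∀ {F : Graph U} {x y} → E F x y → x ≢ y → V F y → Dist F x y 1
  dist-edge e x≢y y∈F = e ∷ [] y∈F , λ { zero w → contradiction (walk₀-≡ w) x≢y ; (suc m) _ → s≤s z≤n }

  module _ {F : Graph U} (E-sym : ∀ x y → E F x y → E F y x) (E-in-V : ∀ x y → E F x y → V F x × V F y) where

    walk-reverse : ∀ {x y n} → Walk F x y n → Walk F y x n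
    walk-reverse ([] x∈F) = [] x∈F
    walk-reverse (_∷_ {x} {z} e w) = walk-snoc (walk-reverse w) (E-sym x z e) (proj₁ (E-in-V x z e))

    dist-sym : ∀ {x y d} → Dist F x y d → Dist F y x d
    dist-sym (w , min) = walk-reverse w , λ m w′ → min m (walk-reverse w′)

  -- R is the graph of a partial map from F₁ to F sending each edge to an edge or a loop.
  walk-project : ∀ {F₁ F : Graph U} (R : U → U → Set)
    → (∀ {z a b} → R z a → R z b → a ≡ b)
    → (∀ {a b a′} → E F₁ a b → R a a′ → Σ U λ b′ → R b b′ × (a′ ≡ b′ ⊎ E F a′ b′))
    → (∀ {z z′} → R z z′ → V F z′)
    → ∀ {s t m s′ t′} → Walk F₁ s t m → R s s′ → R t t′ → Σ ℕ λ m′ → m′ ≤ m × Walk F s′ t′ m′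
  walk-project R R-functional R-step R-V ([] _) Rs Rt with R-functional Rs Rt
  ... | refl = zero , z≤n , [] (R-V Rs)
  walk-project R R-functional R-step R-V (e ∷ w) Rs Rt with R-step e Rs
  ... | b′ , Rb , inj₁ refl =
    let m′ , m′≤ , w′ = walk-project R R-functional R-step R-V w Rb Rt in m′ , m≤n⇒m≤1+n m′≤ , w′
  ... | b′ , Rb , inj₂ e′ =
    let m′ , m′≤ , w′ = walk-project R R-functional R-step R-V w Rb Rt in suc m′ , s≤s m′≤ , e′ ∷ w′

  module _ (_≟_ : DecidableEquality U) {F : Graph U} (fin : IsFiniteSimpleGraph F) where
    open IsFiniteSimpleGraph fin

    walk? : ∀ n x y → V F y → Dec (Walk F x y n)
    walk? zero x y y∈F with x ≟ y
    ... | yes refl = yes ([] y∈F)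
    ... | no x≢y = no (x≢y ∘ walk₀-≡)
    walk? (suc n) x y y∈F = map′ from to (any? step? (proj₁ finite))
      where
      step? : ∀ z → Dec (E F x z × Walk F z y n)
      step? z = E-dec x z ×-dec walk? n z y y∈F
      from : Any.Any (λ z → E F x z × Walk F z y n) (proj₁ finite) → Walk F x y (suc n)
      from a = let _ , e , w = Any.satisfied a in e ∷ w
      to : Walk F x y (suc n) → Any.Any (λ z → E F x z × Walk F z y n) (proj₁ finite)
      to (_∷_ {z = z} e w) = Any.map (λ { refl → e , w }) (proj₂ finite z (proj₂ (E-in-V x z e)))

    dist-exists : Connected F → ∀ {x y} → V F x → V F y → Σ ℕ (Dist F x y)
    dist-exists connected {x} {y} x∈F y∈F =
      let n , w = connected x y x∈F y∈F in least (λ m → walk? m x y y∈F) n w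

    some-neighbour : Connected F → AtLeastTwoVertices F → ∀ {w} → V F w → Σ U (E F w)
    some-neighbour connected (a , b , a∈F , b∈F , a≢b) {w} w∈F with a ≟ w
    ... | yes refl = first-step (proj₂ (connected a b w∈F b∈F)) a≢b
    ... | no a≢w = first-step (proj₂ (connected w a w∈F a∈F)) (a≢w ∘ sym)

  farther-neighbour⇒¬maxDist : ∀ {F : Graph U} {x y z d} → E F x z → Dist F z y (suc d) → Dist F x y d → ¬ MaxDistFrom F x y
  farther-neighbour⇒¬maxDist e D-z D-x (_ , max) = 1+n≰n (max _ e _ _ D-z D-x)

  maxDist-embedding : ∀ {F F′ : Graph U} {x y x′ y′} c → V F′ x′
    → (∀ {z′} → E F′ x′ z′ → Σ U λ z → E F x z × (∀ {d} → Dist F′ z′ y′ d → Dist F z y (c + d)))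
    → (∀ {d} → Dist F′ x′ y′ d → Dist F x y (c + d))
    → MaxDistFrom F x y → MaxDistFrom F′ x′ y′
  maxDist-embedding c x′∈ neighbour dist-x (_ , max) = x′∈ , λ _ e dz dx D-z D-x →
    let z , e′ , dist-z = neighbour e in +-cancelˡ-≤ c dz dx (max z e′ (c + dz) (c + dx) (dist-z D-z) (dist-x D-x))

  maxDist-covering : ∀ {F F′ : Graph U} {x y x′ y′} c → V F′ x′
    → (∀ {z′} → E F′ x′ z′ → Σ U λ z → E F x z × Σ ℕ (Dist F z y)
                                   × (∀ {d} → Dist F z y d → Dist F′ z′ y′ (c + d)))
    → Σ ℕ (Dist F x y) → (∀ {d} → Dist F x y d → Dist F′ x′ y′ (c + d))
    → MaxDistFrom F x y → MaxDistFrom F′ x′ y′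
  maxDist-covering c x′∈ neighbour (dx₀ , D-x₀) dist-x (_ , max) = x′∈ , λ _ e dz dx D-z D-x →
    let z , e′ , (dz₀ , D-z₀) , dist-z = neighbour e
    in subst₂ _≤_ (dist-unique (dist-z D-z₀) D-z) (dist-unique (dist-x D-x₀) D-x)
                  (+-monoʳ-≤ c (max z e′ dz₀ dx₀ D-z₀ D-x₀))

  Unique-⊆⇒length-≤ : ∀ {xs ys : List U} → Unique xs → (∀ {x} → x ∈ xs → x ∈ ys) → length xs ≤ length ys
  Unique-⊆⇒length-≤ {[]} _ _ = z≤n
  Unique-⊆⇒length-≤ {x ∷ xs} {ys} (x∉xs ∷ xs!) xs⊆ys with ∈-∃++ (xs⊆ys (here refl))
  ... | as , bs , refl = begin
      suc (length xs)          ≤⟨ s≤s (Unique-⊆⇒length-≤ xs! xs⊆as++bs) ⟩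
      suc (length (as ++ bs))  ≡⟨ cong suc (length-++ as) ⟩
      suc (length as + length bs) ≡⟨ +-suc (length as) (length bs) ⟨
      length as + length (x ∷ bs) ≡⟨ length-++ as ⟨
      length (as ++ x ∷ bs)    ∎
    where
    open ≤-Reasoning
    xs⊆as++bs : ∀ {y} → y ∈ xs → y ∈ as ++ bs
    xs⊆as++bs y∈xs with ∈-++⁻ as (xs⊆ys (there y∈xs))
    ... | inj₁ y∈as = ∈-++⁺ˡ y∈as
    ... | inj₂ (here refl) = contradiction refl (All.lookup x∉xs y∈xs)
    ... | inj₂ (there y∈bs) = ∈-++⁺ʳ as y∈bs

  size-cong : ∀ {A B : Pred U 0ℓ} {n} → A ⊆ B → B ⊆ A → HasSize A n → HasSize B n
  size-cong A⊆B B⊆A (xs , xs! , xs⊆A , A⊆xs , len) =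
    xs , xs! , (λ x → A⊆B x ∘ xs⊆A x) , (λ x → A⊆xs x ∘ B⊆A x) , len

  size-mono : ∀ {A B : Pred U 0ℓ} {m n} → A ⊆ B → HasSize A m → HasSize B n → m ≤ n
  size-mono A⊆B (xs , xs! , xs⊆A , _ , refl) (ys , _ , _ , B⊆ys , refl) =
    Unique-⊆⇒length-≤ xs! λ {x} x∈xs → B⊆ys x (A⊆B x (xs⊆A x x∈xs))

  size-unique : ∀ {A : Pred U 0ℓ} {m n} → HasSize A m → HasSize A n → m ≡ n
  size-unique A-m A-n = ≤-antisym (size-mono (λ _ → id) A-m A-n) (size-mono (λ _ → id) A-n A-m)

  size-∩ : ∀ {S P : Pred U 0ℓ} {n} → Decidable P → HasSize S n → Σ ℕ (HasSize (S ∩ P))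
  size-∩ P? (xs , xs! , xs⊆S , S⊆xs , _) =
    length (filter P? xs) , filter P? xs , Unique.filter⁺ P? xs! ,
    (λ x x∈ → let x∈xs , Px = ∈-filter⁻ P? x∈ in xs⊆S x x∈xs , Px) ,
    (λ x (Sx , Px) → ∈-filter⁺ P? (S⊆xs x Sx) Px) , refl

  size-∪ : ∀ {A B : Pred U 0ℓ} {m n} → (∀ x → A x → B x → ⊥) → HasSize A m → HasSize B n → HasSize (A ∪ B) (m + n)
  size-∪ disjoint (xs , xs! , xs⊆A , A⊆xs , refl) (ys , ys! , ys⊆B , B⊆ys , refl) =
    xs ++ ys ,
    Unique.++⁺ xs! ys! (λ (x∈xs , x∈ys) → disjoint _ (xs⊆A _ x∈xs) (ys⊆B _ x∈ys)) ,
    (λ x x∈ → ⊎-map (xs⊆A x) (ys⊆B x) (∈-++⁻ xs x∈)) ,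
    (λ { x (inj₁ Ax) → ∈-++⁺ˡ (A⊆xs x Ax) ; x (inj₂ Bx) → ∈-++⁺ʳ xs (B⊆ys x Bx) }) ,
    length-++ xs

  size-⋃ : ∀ {k} {B : Fin k → Pred U 0ℓ} {n : Fin k → ℕ} → (∀ i j x → B i x → B j x → i ≡ j) →
    (∀ i → HasSize (B i) (n i)) → HasSize (⋃ (Fin k) B) (sum n)
  size-⋃ {zero} _ _ = [] , [] , (λ _ ()) , (λ _ ()) , refl
  size-⋃ {suc k} {B} disjoint B-n =
    size-cong split merge (size-∪ (λ x B₀x (i , Bᵢx) → 0≢1+n (disjoint zero (suc i) x B₀x Bᵢx)) (B-n zero)
                                   (size-⋃ (λ i j x Bix Bjx → suc-injectiveᶠ (disjoint (suc i) (suc j) x Bix Bjx)) (B-n ∘ suc)))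
    where
    split : (B zero ∪ ⋃ (Fin k) (B ∘ suc)) ⊆ ⋃ (Fin (suc k)) B
    split x (inj₁ B₀x) = zero , B₀x
    split x (inj₂ (i , Bx)) = suc i , Bx
    merge : ⋃ (Fin (suc k)) B ⊆ (B zero ∪ ⋃ (Fin k) (B ∘ suc))
    merge x (zero , Bx) = inj₁ Bx
    merge x (suc i , Bx) = inj₂ (i , Bx)

  HasSize⇒Decidable : ∀ {S : Pred U 0ℓ} {n} → DecidableEquality U → HasSize S n → Decidable S
  HasSize⇒Decidable _≟_ (xs , _ , xs⊆S , S⊆xs , _) x = map′ (xs⊆S x) (S⊆xs x) (x ∈? xs)
    where open import Data.List.Membership.DecPropositional _≟_ using (_∈?_)

  module _ {F : Graph U} {S : Pred U 0ℓ} where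

    cover-⊆V : IsVC F S → S ⊆ V F
    cover-⊆V = proj₁

    cover-edge : IsVC F S → ∀ x y → E F x y → S x ⊎ S y
    cover-edge = proj₂

    mvc⇒vc : IsMVC F S → IsVC F S
    mvc⇒vc = proj₁

    xvc⇒vc : ∀ {M} → IsXVC F M S → IsVC F S
    xvc⇒vc = proj₁

    xvc-⊇ : ∀ {M} → IsXVC F M S → M ⊆ S
    xvc-⊇ = proj₁ ∘ proj₂

  mvc-size : ∀ {F : Graph U} {S} → IsMVC F S → Σ ℕ (HasSize S)
  mvc-size (_ , n , S-n , _) = n , S-n

  xvc-size : ∀ {F : Graph U} {M S} → IsXVC F M S → Σ ℕ (HasSize S)
  xvc-size (_ , _ , n , S-n , _) = n , S-n

  module _ {F : Graph U} where

    mvc-minimal : ∀ {S S′ : Pred U 0ℓ} {n m} → IsMVC F S → HasSize S n → IsVC F S′ → HasSize S′ m → n ≤ m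
    mvc-minimal (_ , _ , S-n₀ , minimal) S-n S′-cover S′-m =
      subst (_≤ _) (size-unique S-n₀ S-n) (minimal _ _ S′-cover S′-m)

    xvc-minimal : ∀ {M S S′ : Pred U 0ℓ} {n m} →
      IsXVC F M S → HasSize S n → IsVC F S′ → M ⊆ S′ → HasSize S′ m → n ≤ m
    xvc-minimal (_ , _ , _ , S-n₀ , minimal) S-n S′-cover M⊆S′ S′-m =
      subst (_≤ _) (size-unique S-n₀ S-n) (minimal _ _ S′-cover M⊆S′ S′-m)

    mvc-among : ∀ {k} (W : Fin (suc k) → Pred U 0ℓ) (n : Fin (suc k) → ℕ) →
      (∀ i → IsVC F (W i)) → (∀ i → HasSize (W i) (n i)) →
      (∀ S m → IsVC F S → HasSize S m → Σ (Fin (suc k)) λ i → n i ≤ m) →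
      Σ (Fin (suc k)) λ i → IsMVC F (W i)
    mvc-among W n cover size dominated =
      let i , n-i-least = argmin n
      in i , cover i , n i , size i ,
         λ S m S-cover S-m → let j , n-j≤m = dominated S m S-cover S-m in ≤-trans (n-i-least j) n-j≤m

    cover-restrict : ∀ {F′ : Graph U} {S : Pred U 0ℓ} → (∀ {x y} → E F′ x y → E F x y) →
      (∀ {x y} → E F′ x y → V F′ x × V F′ y) → IsVC F S → IsVC F′ (S ∩ V F′)
    cover-restrict E′⊆E E′-in-V′ (_ , covers) =
      (λ _ → proj₂) ,
      λ x y e → ⊎-map (_, proj₁ (E′-in-V′ e)) (_, proj₂ (E′-in-V′ e)) (covers x y (E′⊆E e))

    cover-common-neighbour : ∀ {S P : Pred U 0ℓ} {y} → IsVC F S → Decidable S → ¬ (P ⊆ S) →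
      (∀ x → P x → E F x y) → S y
    cover-common-neighbour {y = y} (_ , covers) S? P⊈S adjacent with S? y
    ... | yes Sy = Sy
    ... | no ¬Sy = contradiction (λ x Px → [ id , (λ Sy → contradiction Sy ¬Sy) ] (covers x y (adjacent x Px))) P⊈S

module Composition {U : Set} (_≟_ : DecidableEquality U) (k : ℕ)
    (G : Fin k → Graph U) (H : Graph U)
    (G-finite : ∀ i → IsFiniteSimpleGraph (G i)) (H-finite : IsFiniteSimpleGraph H)
    (G-connected : ∀ i → Connected (G i)) (H-connected : Connected H)
    (G-two : ∀ i → AtLeastTwoVertices (G i)) (H-two : AtLeastTwoVertices H)
    (G-disjoint : ∀ i j → i ≢ j → ∀ x → V (G i) x → ¬ V (G j) x)
    (GH-disjoint : ∀ i x → V (G i) x → ¬ V H x)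
    (u v : Fin k → U) (u∈G : ∀ i → V (G i) (u i)) (v∈H : ∀ i → V H (v i)) where

  module FG i = IsFiniteSimpleGraph (G-finite i)
  module FH = IsFiniteSimpleGraph H-finite

  J : Graph U
  J = compose k G H u v

  GSide : Fin k → Pred U 0ℓ
  GSide i x = V (G i) x × x ≢ u i

  Glue : Pred U 0ℓ
  Glue x = Σ (Fin k) λ i → x ≡ v i

  HSide : Pred U 0ℓ
  HSide x = V H x × ¬ Glue x

  G-index-unique : ∀ {i j x} → V (G i) x → V (G j) x → i ≡ j
  G-index-unique {i} {j} {x} x∈Gi x∈Gj with i ≟ᶠ j
  ... | yes i≡j = i≡j
  ... | no i≢j = contradiction x∈Gj (G-disjoint i j i≢j x x∈Gi)

  H∉GSide : ∀ {i x} → V H x → ¬ GSide i x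
  H∉GSide {i} x∈H (x∈Gi , _) = GH-disjoint i _ x∈Gi x∈H

  GSide-disjoint : ∀ {i j x} → GSide i x → j ≢ i → ¬ GSide j x
  GSide-disjoint (x∈Gi , _) j≢i (x∈Gj , _) = j≢i (G-index-unique x∈Gj x∈Gi)

  GSide? : ∀ i → Decidable (GSide i)
  GSide? i x = FG.V-dec i x ×-dec ¬? (x ≟ u i)

  Glue? : Decidable Glue
  Glue? x = anyᶠ? (λ i → x ≟ v i)

  HSide? : Decidable HSide
  HSide? x = FH.V-dec x ×-dec ¬? (Glue? x)

  H⇒J : ∀ {x} → V H x → V J x
  H⇒J x∈H = inj₂ x∈H , λ i x≡u → GH-disjoint i _ (subst (V (G i)) (sym x≡u) (u∈G i)) x∈H

  GSide⇒J : ∀ {i x} → GSide i x → V J x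
  GSide⇒J {i} (x∈Gi , x≢u) = inj₁ (i , x∈Gi) , λ j x≡uj →
    x≢u (subst (λ j → _ ≡ u j) (G-index-unique (subst (V (G j)) (sym x≡uj) (u∈G j)) x∈Gi) x≡uj)

  J-vertex-cases : ∀ {x} → V J x → V H x ⊎ Σ (Fin k) λ i → GSide i x
  J-vertex-cases (inj₂ x∈H , _) = inj₁ x∈H
  J-vertex-cases (inj₁ (i , x∈Gi) , x≢u) = inj₂ (i , x∈Gi , x≢u i)

  data JEdge (a b : U) : Set where
    G-edge  : ∀ i → E (G i) a b → GSide i a → GSide i b → JEdge a b
    H-edge  : E H a b → JEdge a b
    attachˡ : ∀ i → E (G i) a (u i) → GSide i a → b ≡ v i → JEdge a b
    attachʳ : ∀ i → E (G i) b (u i) → GSide i b → a ≡ v i → JEdge a b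

  J-edge-cases : ∀ {a b} → E J a b → JEdge a b
  J-edge-cases {a} {b} (inj₁ (inj₁ (i , e)) , not-removed) =
    G-edge i e (proj₁ (FG.E-in-V i a b e) , λ { refl → not-removed (i , inj₂ (FG.E-sym i a b e , refl)) })
               (proj₂ (FG.E-in-V i a b e) , λ { refl → not-removed (i , inj₁ (e , refl)) })
  J-edge-cases (inj₁ (inj₂ e) , _) = H-edge e
  J-edge-cases {a} (inj₂ (i , inj₁ (e , b≡v)) , _) =
    attachˡ i e (proj₁ (FG.E-in-V i a (u i) e) , λ { refl → FG.E-irrefl i _ e }) b≡v
  J-edge-cases {b = b} (inj₂ (i , inj₂ (e , a≡v)) , _) =
    attachʳ i e (proj₁ (FG.E-in-V i b (u i) e) , λ { refl → FG.E-irrefl i _ e }) a≡v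

  removed-in-G : ∀ {x y} → (Σ (Fin k) λ i → (E (G i) x (u i) × y ≡ u i) ⊎ (E (G i) y (u i) × x ≡ u i))
    → Σ (Fin k) λ m → V (G m) x × V (G m) y × (x ≡ u m ⊎ y ≡ u m)
  removed-in-G {x} (m , inj₁ (e , refl)) = m , proj₁ (FG.E-in-V m x (u m) e) , u∈G m , inj₂ refl
  removed-in-G {y = y} (m , inj₂ (e , refl)) = m , u∈G m , proj₁ (FG.E-in-V m y (u m) e) , inj₁ refl

  G-edge⇒J : ∀ {i a b} → E (G i) a b → GSide i a → GSide i b → E J a b
  G-edge⇒J {i} {a} {b} e (a∈G , a≢u) (b∈G , b≢u) = inj₁ (inj₁ (i , e)) , λ r → not-removed (removed-in-G r)
    where
    not-removed : (Σ (Fin k) λ m → V (G m) a × V (G m) b × (a ≡ u m ⊎ b ≡ u m)) → ⊥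
    not-removed (m , a∈Gm , _ , inj₁ a≡u) with G-index-unique a∈G a∈Gm
    ... | refl = a≢u a≡u
    not-removed (m , _ , b∈Gm , inj₂ b≡u) with G-index-unique b∈G b∈Gm
    ... | refl = b≢u b≡u

  H-edge⇒J : ∀ {a b} → E H a b → E J a b
  H-edge⇒J {a} {b} e = inj₁ (inj₂ e) , λ r →
    let m , a∈Gm , _ = removed-in-G r in GH-disjoint m a a∈Gm (proj₁ (FH.E-in-V a b e))

  attachˡ⇒J : ∀ {i a} → E (G i) a (u i) → E J a (v i)
  attachˡ⇒J {i} e = inj₂ (i , inj₁ (e , refl)) , λ r →
    let m , _ , v∈Gm , _ = removed-in-G r in GH-disjoint m _ v∈Gm (v∈H i)

  attachʳ⇒J : ∀ {i b} → E (G i) b (u i) → E J (v i) b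
  attachʳ⇒J {i} e = inj₂ (i , inj₂ (e , refl)) , λ r →
    let m , v∈Gm , _ = removed-in-G r in GH-disjoint m _ v∈Gm (v∈H i)

  E-J-sym : ∀ a b → E J a b → E J b a
  E-J-sym a b e with J-edge-cases e
  ... | G-edge i e′ a∈ b∈ = G-edge⇒J (FG.E-sym i a b e′) b∈ a∈
  ... | H-edge e′ = H-edge⇒J (FH.E-sym a b e′)
  ... | attachˡ i e′ _ refl = attachʳ⇒J e′
  ... | attachʳ i e′ _ refl = attachˡ⇒J e′

  E-J-in-V : ∀ a b → E J a b → V J a × V J b
  E-J-in-V a b e with J-edge-cases e
  ... | G-edge i _ a∈ b∈ = GSide⇒J a∈ , GSide⇒J b∈
  ... | H-edge e′ = H⇒J (proj₁ (FH.E-in-V a b e′)) , H⇒J (proj₂ (FH.E-in-V a b e′))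
  ... | attachˡ i _ a∈ refl = GSide⇒J a∈ , H⇒J (v∈H i)
  ... | attachʳ i _ b∈ refl = H⇒J (v∈H i) , GSide⇒J b∈

  dist-J-sym : ∀ {x y d} → Dist J x y d → Dist J y x d
  dist-J-sym = dist-sym E-J-sym E-J-in-V

  dist-H-sym : ∀ {x y d} → Dist H x y d → Dist H y x d
  dist-H-sym = dist-sym FH.E-sym FH.E-in-V

  dist-G-sym : ∀ {i x y d} → Dist (G i) x y d → Dist (G i) y x d
  dist-G-sym {i} = dist-sym (FG.E-sym i) (FG.E-in-V i)

  dist-G-exists : ∀ i {x y} → V (G i) x → V (G i) y → Σ ℕ (Dist (G i) x y)
  dist-G-exists i = dist-exists _≟_ (G-finite i) (G-connected i)

  dist-H-exists : ∀ {x y} → V H x → V H y → Σ ℕ (Dist H x y)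
  dist-H-exists = dist-exists _≟_ H-finite H-connected

  embed : Fin k → U → U
  embed i x with x ≟ u i
  ... | yes _ = v i
  ... | no _ = x

  embed-u : ∀ i → embed i (u i) ≡ v i
  embed-u i with u i ≟ u i
  ... | yes _ = refl
  ... | no u≢u = contradiction refl u≢u

  embed-GSide : ∀ {i x} → x ≢ u i → embed i x ≡ x
  embed-GSide {i} {x} x≢u with x ≟ u i
  ... | yes x≡u = contradiction x≡u x≢u
  ... | no _ = refl

  embed-edge : ∀ {i a b} → E (G i) a b → E J (embed i a) (embed i b)
  embed-edge {i} {a} {b} e with a ≟ u i | b ≟ u i
  ... | yes refl | yes refl = contradiction e (FG.E-irrefl i _)
  ... | yes refl | no _ = attachʳ⇒J (FG.E-sym i _ _ e)
  ... | no _ | yes refl = attachˡ⇒J e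
  ... | no a≢u | no b≢u = G-edge⇒J e (proj₁ (FG.E-in-V i a b e) , a≢u) (proj₂ (FG.E-in-V i a b e) , b≢u)

  embed-vertex : ∀ {i a} → V (G i) a → V J (embed i a)
  embed-vertex {i} {a} a∈G with a ≟ u i
  ... | yes _ = H⇒J (v∈H i)
  ... | no a≢u = GSide⇒J (a∈G , a≢u)

  embed-walk : ∀ {i a b n} → Walk (G i) a b n → Walk J (embed i a) (embed i b) n
  embed-walk ([] a∈G) = [] (embed-vertex a∈G)
  embed-walk (e ∷ w) = embed-edge e ∷ embed-walk w

  H-walk⇒J : ∀ {a b n} → Walk H a b n → Walk J a b n
  H-walk⇒J ([] a∈H) = [] (H⇒J a∈H)
  H-walk⇒J (e ∷ w) = H-edge⇒J e ∷ H-walk⇒J w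

  -- Collapsing each G i onto v i maps J onto H.
  ToH : U → U → Set
  ToH z z′ = (V H z × z′ ≡ z) ⊎ Σ (Fin k) λ i → GSide i z × z′ ≡ v i

  ToH-functional : ∀ {z a b} → ToH z a → ToH z b → a ≡ b
  ToH-functional (inj₁ (_ , refl)) (inj₁ (_ , refl)) = refl
  ToH-functional (inj₁ (z∈H , _)) (inj₂ (_ , z∈G , _)) = contradiction z∈G (H∉GSide z∈H)
  ToH-functional (inj₂ (_ , z∈G , _)) (inj₁ (z∈H , _)) = contradiction z∈G (H∉GSide z∈H)
  ToH-functional (inj₂ (_ , z∈Gi , refl)) (inj₂ (_ , z∈Gj , refl)) = cong v (G-index-unique (proj₁ z∈Gi) (proj₁ z∈Gj))

  ToH-GSide : ∀ {i z z′} → GSide i z → ToH z z′ → z′ ≡ v i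
  ToH-GSide z∈G r = ToH-functional r (inj₂ (_ , z∈G , refl))

  ToH-H : ∀ {z z′} → V H z → ToH z z′ → z′ ≡ z
  ToH-H z∈H r = ToH-functional r (inj₁ (z∈H , refl))

  ToH-step : ∀ {a b a′} → E J a b → ToH a a′ → Σ U λ b′ → ToH b b′ × (a′ ≡ b′ ⊎ E H a′ b′)
  ToH-step {a} {b} e r with J-edge-cases e
  ... | G-edge i _ a∈ b∈ = v i , inj₂ (i , b∈ , refl) , inj₁ (ToH-GSide a∈ r)
  ... | H-edge e′ with ToH-H (proj₁ (FH.E-in-V a b e′)) r
  ...   | refl = b , inj₁ (proj₂ (FH.E-in-V a b e′) , refl) , inj₂ e′
  ToH-step e r | attachˡ i _ a∈ refl = v i , inj₁ (v∈H i , refl) , inj₁ (ToH-GSide a∈ r)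
  ToH-step e r | attachʳ i _ b∈ refl = v i , inj₂ (i , b∈ , refl) , inj₁ (ToH-H (v∈H i) r)

  ToH-V : ∀ {z z′} → ToH z z′ → V H z′
  ToH-V (inj₁ (z∈H , refl)) = z∈H
  ToH-V (inj₂ (i , _ , refl)) = v∈H i

  -- Collapsing everything outside G i onto u i maps J onto G i.
  ToG : Fin k → U → U → Set
  ToG i z z′ = (GSide i z × z′ ≡ z) ⊎ (¬ GSide i z × z′ ≡ u i)

  ToG-functional : ∀ {i z a b} → ToG i z a → ToG i z b → a ≡ b
  ToG-functional (inj₁ (_ , refl)) (inj₁ (_ , refl)) = refl
  ToG-functional (inj₁ (z∈ , _)) (inj₂ (z∉ , _)) = contradiction z∈ z∉
  ToG-functional (inj₂ (z∉ , _)) (inj₁ (z∈ , _)) = contradiction z∈ z∉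
  ToG-functional (inj₂ (_ , refl)) (inj₂ (_ , refl)) = refl

  ToG-V : ∀ {i z z′} → ToG i z z′ → V (G i) z′
  ToG-V (inj₁ (z∈ , refl)) = proj₁ z∈
  ToG-V {i} (inj₂ (_ , refl)) = u∈G i

  ToG-in : ∀ {i z z′} → GSide i z → ToG i z z′ → z′ ≡ z
  ToG-in z∈ r = ToG-functional r (inj₁ (z∈ , refl))

  ToG-out : ∀ {i z z′} → ¬ GSide i z → ToG i z z′ → z′ ≡ u i
  ToG-out z∉ r = ToG-functional r (inj₂ (z∉ , refl))

  ToG-step : ∀ i {a b a′} → E J a b → ToG i a a′ → Σ U λ b′ → ToG i b b′ × (a′ ≡ b′ ⊎ E (G i) a′ b′)
  ToG-step i {a} {b} e r with J-edge-cases e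
  ... | G-edge m e′ a∈ b∈ with m ≟ᶠ i
  ...   | yes refl with ToG-in a∈ r
  ...     | refl = b , inj₁ (b∈ , refl) , inj₂ e′
  ToG-step i e r | G-edge m _ a∈ b∈ | no m≢i =
    u i , inj₂ (GSide-disjoint b∈ (m≢i ∘ sym) , refl) , inj₁ (ToG-out (GSide-disjoint a∈ (m≢i ∘ sym)) r)
  ToG-step i {a} {b} e r | H-edge e′ =
    u i , inj₂ (H∉GSide (proj₂ (FH.E-in-V a b e′)) , refl) , inj₁ (ToG-out (H∉GSide (proj₁ (FH.E-in-V a b e′))) r)
  ToG-step i e r | attachˡ m e′ a∈ refl with m ≟ᶠ i
  ... | yes refl with ToG-in a∈ r
  ...   | refl = u i , inj₂ (H∉GSide (v∈H m) , refl) , inj₂ e′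
  ToG-step i e r | attachˡ m _ a∈ refl | no m≢i =
    u i , inj₂ (H∉GSide (v∈H m) , refl) , inj₁ (ToG-out (GSide-disjoint a∈ (m≢i ∘ sym)) r)
  ToG-step i {b = b} e r | attachʳ m e′ b∈ refl with m ≟ᶠ i
  ... | yes refl with ToG-out (H∉GSide (v∈H m)) r
  ...   | refl = b , inj₁ (b∈ , refl) , inj₂ (FG.E-sym m _ _ e′)
  ToG-step i e r | attachʳ m _ b∈ refl | no m≢i =
    u i , inj₂ (GSide-disjoint b∈ (m≢i ∘ sym) , refl) , inj₁ (ToG-out (H∉GSide (v∈H m)) r)

  leave-GSide : ∀ {i x t m} → GSide i x → ¬ GSide i t → Walk J x t m →
    Σ ℕ λ p → Σ ℕ λ q → Walk (G i) x (u i) p × Walk J (v i) t q × p + q ≡ m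
  leave-GSide x∈ t∉ ([] _) = contradiction x∈ t∉
  leave-GSide {i} x∈ t∉ (e ∷ w) with J-edge-cases e
  ... | G-edge m e′ a∈ b∈ with G-index-unique (proj₁ a∈) (proj₁ x∈)
  ...   | refl = let p , q , w-G , w-J , p+q≡ = leave-GSide b∈ t∉ w in suc p , q , e′ ∷ w-G , w-J , cong suc p+q≡
  leave-GSide x∈ t∉ (e ∷ w) | H-edge e′ = contradiction x∈ (H∉GSide (proj₁ (FH.E-in-V _ _ e′)))
  leave-GSide {i} x∈ t∉ (_∷_ {n = n} e w) | attachˡ m e′ a∈ refl with G-index-unique (proj₁ a∈) (proj₁ x∈)
  ... | refl = 1 , n , e′ ∷ [] (u∈G i) , w , refl
  leave-GSide x∈ t∉ (e ∷ w) | attachʳ m _ _ refl = contradiction x∈ (H∉GSide (v∈H m))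

  dist-H⇒J : ∀ {p q d} → V H p → V H q → Dist H p q d → Dist J p q d
  dist-H⇒J p∈ q∈ (w , min) = H-walk⇒J w , λ m w′ →
    let m′ , m′≤m , w-H = walk-project ToH ToH-functional ToH-step ToH-V w′ (inj₁ (p∈ , refl)) (inj₁ (q∈ , refl))
    in ≤-trans (min m′ w-H) m′≤m

  dist-G⇒J : ∀ {i p q d} → GSide i p → GSide i q → Dist (G i) p q d → Dist J p q d
  dist-G⇒J {i} {p} {q} p∈ q∈ (w , min) = w-J , λ m w′ →
    let m′ , m′≤m , w-G = walk-project (ToG i) ToG-functional (ToG-step i) ToG-V w′ (inj₁ (p∈ , refl)) (inj₁ (q∈ , refl))
    in ≤-trans (min m′ w-G) m′≤m
    where
    w-J : Walk J p q _
    w-J = subst₂ (λ a b → Walk J a b _) (embed-GSide (proj₂ p∈)) (embed-GSide (proj₂ q∈)) (embed-walk w)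

  dist-via-v : ∀ {i x y a c} → GSide i x → ¬ GSide i y → Dist (G i) x (u i) a → Dist J (v i) y c → Dist J x y (a + c)
  dist-via-v {i} x∈ y∉ (w-a , min-a) (w-c , min-c) = walk-++ w-x w-c , λ m w →
    let p , q , w-G , w-J , p+q≡m = leave-GSide x∈ y∉ w in subst (_ ≤_) p+q≡m (+-mono-≤ (min-a p w-G) (min-c q w-J))
    where
    w-x : Walk J _ (v i) _
    w-x = subst₂ (λ a b → Walk J a b _) (embed-GSide (proj₂ x∈)) (embed-u i) (embed-walk w-a)

  dist-from-H-exists : ∀ {w y} → V H w → V J y → Σ ℕ (Dist J w y)
  dist-from-H-exists w∈ y∈ with J-vertex-cases y∈
  ... | inj₁ y∈H = let d , D = dist-H-exists w∈ y∈H in d , dist-H⇒J w∈ y∈H D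
  ... | inj₂ (i , y∈G) =
    let a , D-a = dist-G-exists i (proj₁ y∈G) (u∈G i)
        b , D-b = dist-H-exists (v∈H i) w∈
    in a + b , dist-J-sym (dist-via-v y∈G (H∉GSide w∈) D-a (dist-H⇒J (v∈H i) w∈ D-b))

  J-neighbour-HSide : ∀ {x z} → HSide x → E J x z → E H x z
  J-neighbour-HSide x∈ e with J-edge-cases e
  ... | G-edge _ _ a∈ _ = contradiction a∈ (H∉GSide (proj₁ x∈))
  ... | H-edge e′ = e′
  ... | attachˡ _ _ a∈ _ = contradiction a∈ (H∉GSide (proj₁ x∈))
  ... | attachʳ i _ _ x≡v = contradiction (i , x≡v) (proj₂ x∈)

  J-neighbour-GSide : ∀ {i x z} → GSide i x → E J x z → Σ U λ z′ → E (G i) x z′ × z ≡ embed i z′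
  J-neighbour-GSide x∈ e with J-edge-cases e
  ... | G-edge _ e′ a∈ b∈ with G-index-unique (proj₁ a∈) (proj₁ x∈)
  ...   | refl = _ , e′ , sym (embed-GSide (proj₂ b∈))
  J-neighbour-GSide x∈ e | H-edge e′ = contradiction x∈ (H∉GSide (proj₁ (FH.E-in-V _ _ e′)))
  J-neighbour-GSide {i} x∈ e | attachˡ _ e′ a∈ refl with G-index-unique (proj₁ a∈) (proj₁ x∈)
  ... | refl = u i , e′ , sym (embed-u i)
  J-neighbour-GSide x∈ e | attachʳ m _ _ refl = contradiction x∈ (H∉GSide (v∈H m))

  embed-edge-GSide : ∀ {i x z} → GSide i x → E (G i) x z → E J x (embed i z)
  embed-edge-GSide x∈ e = subst (λ a → E J a _) (embed-GSide (proj₂ x∈)) (embed-edge e)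

  dist-embed : ∀ {i z y d} → V (G i) z → GSide i y → Dist (G i) z y d → Dist J (embed i z) y d
  dist-embed {i} {z} {y} {d} z∈ y∈ D with z ≟ u i
  ... | yes refl = dist-J-sym (subst (Dist J y (v i)) (+-identityʳ d)
                     (dist-via-v y∈ (H∉GSide (v∈H i)) (dist-G-sym D) (dist-refl (H⇒J (v∈H i)))))
  ... | no z≢u = dist-G⇒J (z∈ , z≢u) y∈ D

  maxDist-J⇒H : ∀ {x y} → V H x → V H y → MaxDistFrom J x y → MaxDistFrom H x y
  maxDist-J⇒H x∈ y∈ = maxDist-embedding 0 x∈
    (λ e → _ , H-edge⇒J e , dist-H⇒J (proj₂ (FH.E-in-V _ _ e)) y∈) (dist-H⇒J x∈ y∈)

  maxDist-H⇒J : ∀ {x y} → HSide x → V H y → MaxDistFrom H x y → MaxDistFrom J x y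
  maxDist-H⇒J x∈ y∈ = maxDist-covering 0 (H⇒J (proj₁ x∈))
    (λ e → let e′ = J-neighbour-HSide x∈ e ; z∈ = proj₂ (FH.E-in-V _ _ e′)
           in _ , e′ , dist-H-exists z∈ y∈ , dist-H⇒J z∈ y∈)
    (dist-H-exists (proj₁ x∈) y∈) (dist-H⇒J (proj₁ x∈) y∈)

  maxDist-J⇒G : ∀ {i x y} → GSide i x → GSide i y → MaxDistFrom J x y → MaxDistFrom (G i) x y
  maxDist-J⇒G {i} x∈ y∈ = maxDist-embedding 0 (proj₁ x∈)
    (λ e → _ , embed-edge-GSide x∈ e , dist-embed (proj₂ (FG.E-in-V i _ _ e)) y∈) (dist-G⇒J x∈ y∈)

  maxDist-G⇒J : ∀ {i x y} → GSide i x → GSide i y → MaxDistFrom (G i) x y → MaxDistFrom J x y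
  maxDist-G⇒J {i} x∈ y∈ = maxDist-covering 0 (GSide⇒J x∈) neighbour
    (dist-G-exists i (proj₁ x∈) (proj₁ y∈)) (dist-G⇒J x∈ y∈)
    where
    neighbour : ∀ {z} → E J _ z → Σ U λ z′ → E (G i) _ z′ × Σ ℕ (Dist (G i) z′ _)
                                            × (∀ {d} → Dist (G i) z′ _ d → Dist J z _ d)
    neighbour e with J-neighbour-GSide x∈ e
    ... | z′ , e′ , refl = let z′∈ = proj₂ (FG.E-in-V i _ _ e′)
                           in z′ , e′ , dist-G-exists i z′∈ (proj₁ y∈) , dist-embed z′∈ y∈

  -- Paths from G i to y leave through u i ~ v i, so distances to y are those to u i shifted by c = d(v i, y).
  module LeavingG {i x y} (x∈ : GSide i x) (y∈J : V J y) (y∉ : ¬ GSide i y) where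

    c : ℕ
    c = proj₁ (dist-from-H-exists (v∈H i) y∈J)

    D-c : Dist J (v i) y c
    D-c = proj₂ (dist-from-H-exists (v∈H i) y∈J)

    dist-through-u : ∀ {z a} → V (G i) z → Dist (G i) z (u i) a → Dist J (embed i z) y (c + a)
    dist-through-u {z} {a} z∈ D with z ≟ u i
    ... | yes refl with dist-unique D (dist-refl (u∈G i))
    ...   | refl = subst (Dist J (v i) y) (sym (+-identityʳ c)) D-c
    dist-through-u {z} {a} z∈ D | no z≢u = subst (Dist J z y) (+-comm a c) (dist-via-v (z∈ , z≢u) y∉ D D-c)

    maxDist-J⇒G-u : MaxDistFrom J x y → MaxDistFrom (G i) x (u i)
    maxDist-J⇒G-u = maxDist-embedding c (proj₁ x∈)
      (λ e → _ , embed-edge-GSide x∈ e , dist-through-u (proj₂ (FG.E-in-V i _ _ e)))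
      (subst (λ w → Dist J w y _) (embed-GSide (proj₂ x∈)) ∘ dist-through-u (proj₁ x∈))

    maxDist-G-u⇒J : MaxDistFrom (G i) x (u i) → MaxDistFrom J x y
    maxDist-G-u⇒J = maxDist-covering c (GSide⇒J x∈) neighbour
      (dist-G-exists i (proj₁ x∈) (u∈G i))
      (subst (λ w → Dist J w y _) (embed-GSide (proj₂ x∈)) ∘ dist-through-u (proj₁ x∈))
      where
      neighbour : ∀ {z} → E J x z → Σ U λ z′ → E (G i) x z′ × Σ ℕ (Dist (G i) z′ (u i))
                                              × (∀ {d} → Dist (G i) z′ (u i) d → Dist J z y (c + d))
      neighbour e with J-neighbour-GSide x∈ e
      ... | z′ , e′ , refl = let z′∈ = proj₂ (FG.E-in-V i _ _ e′)
                             in z′ , e′ , dist-G-exists i z′∈ (u∈G i) , dist-through-u z′∈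

  open LeavingG public using (maxDist-J⇒G-u; maxDist-G-u⇒J)

  -- Dually, distances from H to x are those to v j shifted by a = d(x, u j).
  module EnteringG {j x y} (x∈ : GSide j x) (y∈ : V H y) where

    a : ℕ
    a = proj₁ (dist-G-exists j (proj₁ x∈) (u∈G j))

    dist-through-v : ∀ {z b} → V H z → Dist H z (v j) b → Dist J z x (a + b)
    dist-through-v z∈ D = dist-J-sym (dist-via-v x∈ (H∉GSide z∈) (proj₂ (dist-G-exists j (proj₁ x∈) (u∈G j)))
                                                   (dist-H⇒J (v∈H j) z∈ (dist-H-sym D)))

    maxDist-J⇒H-v : MaxDistFrom J y x → MaxDistFrom H y (v j)
    maxDist-J⇒H-v = maxDist-embedding a y∈
      (λ e → _ , H-edge⇒J e , dist-through-v (proj₂ (FH.E-in-V _ _ e))) (dist-through-v y∈)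

    maxDist-H-v⇒J : ¬ Glue y → MaxDistFrom H y (v j) → MaxDistFrom J y x
    maxDist-H-v⇒J y∉ = maxDist-covering a (H⇒J y∈)
      (λ e → let e′ = J-neighbour-HSide (y∈ , y∉) e ; z∈ = proj₂ (FH.E-in-V _ _ e′)
             in _ , e′ , dist-H-exists z∈ (v∈H j) , dist-through-v z∈)
      (dist-H-exists y∈ (v∈H j)) (dist-through-v y∈)

  open EnteringG public using (maxDist-J⇒H-v; maxDist-H-v⇒J)

  -- v m has a neighbour on the side of u m not containing y, one step farther from y.
  glue-¬maxDist : ∀ {m y} → V J y → ¬ MaxDistFrom J (v m) y
  glue-¬maxDist {m} {y} y∈ with GSide? m y
  ... | yes y∈G =
    let h , e = some-neighbour _≟_ H-finite H-connected H-two (v∈H m)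
        h∈ = proj₂ (FH.E-in-V _ h e)
        a , D-a = dist-G-exists m (proj₁ y∈G) (u∈G m)
        v≢h = λ v≡h → FH.E-irrefl _ (subst (E H (v m)) (sym v≡h) e)
    in farther-neighbour⇒¬maxDist (H-edge⇒J e)
         (dist-J-sym (subst (Dist J y h) (+-comm a 1)
           (dist-via-v y∈G (H∉GSide h∈) D-a (dist-edge (H-edge⇒J e) v≢h (H⇒J h∈)))))
         (dist-J-sym (subst (Dist J y (v m)) (+-identityʳ a) (dist-via-v y∈G (H∉GSide (v∈H m)) D-a (dist-refl (H⇒J (v∈H m))))))
  ... | no y∉G =
    let w , e = some-neighbour _≟_ (G-finite m) (G-connected m) (G-two m) (u∈G m)
        w≢u = λ w≡u → FG.E-irrefl m _ (subst (E (G m) (u m)) w≡u e)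
        w∈ = proj₂ (FG.E-in-V m _ w e) , w≢u
        c , D-c = dist-from-H-exists (v∈H m) y∈
    in farther-neighbour⇒¬maxDist (attachʳ⇒J (FG.E-sym m _ _ e))
         (dist-via-v w∈ y∉G (dist-edge (FG.E-sym m _ _ e) w≢u (u∈G m)) D-c) D-c

  MDu : Fin k → Pred U 0ℓ
  MDu i = MD (G i) (u i)

  MDv : Fin k → Pred U 0ℓ
  MDv j y = MD H (v j) y × ¬ Glue y

  MDu⇒GSide : ∀ {i x} → MDu i x → GSide i x
  MDu⇒GSide {i} x-max = proj₁ x-max , λ { refl →
    let w , e = some-neighbour _≟_ (G-finite i) (G-connected i) (G-two i) (u∈G i)
        w≢u = λ w≡u → FG.E-irrefl i _ (subst (E (G i) (u i)) w≡u e)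
    in farther-neighbour⇒¬maxDist e (dist-edge (FG.E-sym i _ _ e) w≢u (u∈G i)) (dist-refl (u∈G i)) x-max }

  SRH : Graph U
  SRH = SR H ∖ Glue

  SRG : Fin k → Graph U
  SRG i = SR (G i) ∖ (λ x → x ≡ u i)

  Facing : Fin k → Pred U 0ℓ
  Facing i y = MDv i y ⊎ Σ (Fin k) λ m → m ≢ i × MDu m y

  data SREdge (x y : U) : Set where
    in-H   : E SRH x y → SREdge x y
    in-G   : ∀ i → E (SRG i) x y → SREdge x y
    crossˡ : ∀ i → MDu i x → Facing i y → SREdge x y
    crossʳ : ∀ i → MDu i y → Facing i x → SREdge x y

  SR-swap : ∀ {x y} → E (SR J) x y → E (SR J) y x
  SR-swap (x≢y , x-max , y-max) = x≢y ∘ sym , y-max , x-max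

  SR-J-cross : ∀ {i x y} → E (SR J) x y → GSide i x → ¬ GSide i y → MDu i x × Facing i y
  SR-J-cross {i} {x} {y} (_ , x-max , y-max) x∈ y∉ = maxDist-J⇒G-u x∈ y∈J y∉ x-max , facing (J-vertex-cases y∈J)
    where
    x∈J = proj₁ x-max
    y∈J = proj₁ y-max
    facing : V H y ⊎ Σ (Fin k) (λ m → GSide m y) → Facing i y
    facing (inj₁ y∈H) with Glue? y
    ... | yes (m , refl) = contradiction y-max (glue-¬maxDist x∈J)
    ... | no y∉Glue = inj₁ (maxDist-J⇒H-v x∈ y∈H y-max , y∉Glue)
    facing (inj₂ (m , y∈Gm)) with m ≟ᶠ i
    ... | yes refl = contradiction y∈Gm y∉
    ... | no m≢i = inj₂ (m , m≢i , maxDist-J⇒G-u y∈Gm x∈J (GSide-disjoint x∈ m≢i) y-max)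

  SR-J-edge-cases : ∀ {x y} → E (SR J) x y → SREdge x y
  SR-J-edge-cases {x} {y} e@(x≢y , x-max , y-max) with J-vertex-cases (proj₁ x-max)
  ... | inj₂ (i , x∈G) with GSide? i y
  ...   | yes y∈G = in-G i ((x≢y , maxDist-J⇒G x∈G y∈G x-max , maxDist-J⇒G y∈G x∈G y-max) , proj₂ x∈G , proj₂ y∈G)
  ...   | no y∉G = let x∈MD , y-facing = SR-J-cross e x∈G y∉G in crossˡ i x∈MD y-facing
  SR-J-edge-cases {x} {y} e@(x≢y , x-max , y-max) | inj₁ x∈H with Glue? x
  ... | yes (m , refl) = contradiction x-max (glue-¬maxDist (proj₁ y-max))
  ... | no x∉Glue with J-vertex-cases (proj₁ y-max)
  ...   | inj₂ (i , y∈G) = let y∈MD , x-facing = SR-J-cross (SR-swap e) y∈G (H∉GSide x∈H) in crossʳ i y∈MD x-facing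
  ...   | inj₁ y∈H with Glue? y
  ...     | yes (m , refl) = contradiction y-max (glue-¬maxDist (proj₁ x-max))
  ...     | no y∉Glue =
    in-H ((x≢y , maxDist-J⇒H x∈H y∈H x-max , maxDist-J⇒H y∈H x∈H y-max) , x∉Glue , y∉Glue)

  SRH⇒SR-J : ∀ {x y} → E SRH x y → E (SR J) x y
  SRH⇒SR-J ((x≢y , x-max , y-max) , x∉ , y∉) =
    x≢y , maxDist-H⇒J (proj₁ x-max , x∉) (proj₁ y-max) x-max , maxDist-H⇒J (proj₁ y-max , y∉) (proj₁ x-max) y-max

  SRG⇒SR-J : ∀ {i x y} → E (SRG i) x y → E (SR J) x y
  SRG⇒SR-J ((x≢y , x-max , y-max) , x≢u , y≢u) =
    x≢y , maxDist-G⇒J (proj₁ x-max , x≢u) (proj₁ y-max , y≢u) x-max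
        , maxDist-G⇒J (proj₁ y-max , y≢u) (proj₁ x-max , x≢u) y-max

  SRH-E-in-V : ∀ {x y} → E SRH x y → HSide x × HSide y
  SRH-E-in-V ((_ , x-max , y-max) , x∉ , y∉) = (proj₁ x-max , x∉) , (proj₁ y-max , y∉)

  SRG-E-in-V : ∀ {i x y} → E (SRG i) x y → GSide i x × GSide i y
  SRG-E-in-V ((_ , x-max , y-max) , x≢u , y≢u) = (proj₁ x-max , x≢u) , (proj₁ y-max , y≢u)

  MDu-MDv⇒SR-J : ∀ {j x y} → MDu j x → MDv j y → E (SR J) x y
  MDu-MDv⇒SR-J {j} x-max (y-max , y∉) =
    (λ { refl → H∉GSide y∈H x∈ }) ,
    maxDist-G-u⇒J x∈ (H⇒J y∈H) (H∉GSide y∈H) x-max ,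
    maxDist-H-v⇒J x∈ y∈H y∉ y-max
    where
    x∈ = MDu⇒GSide x-max
    y∈H = proj₁ y-max

  MDu-MDu⇒SR-J : ∀ {i j x y} → i ≢ j → MDu i x → MDu j y → E (SR J) x y
  MDu-MDu⇒SR-J i≢j x-max y-max =
    (λ { refl → GSide-disjoint x∈ (i≢j ∘ sym) y∈ }) ,
    maxDist-G-u⇒J x∈ (GSide⇒J y∈) (GSide-disjoint y∈ i≢j) x-max ,
    maxDist-G-u⇒J y∈ (GSide⇒J x∈) (GSide-disjoint x∈ (i≢j ∘ sym)) y-max
    where
    x∈ = MDu⇒GSide x-max
    y∈ = MDu⇒GSide y-max

  module Candidates
      (A₀ : Pred U 0ℓ) (A₀-mvc : IsMVC SRH A₀)
      (B₀ : Fin k → Pred U 0ℓ) (B₀-xvc : ∀ i → IsXVC (SRG i) (MDu i) (B₀ i))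
      (A : Fin k → Pred U 0ℓ) (A-xvc : ∀ j → IsXVC SRH (MDv j) (A j))
      (B : Fin k → Pred U 0ℓ) (B-mvc : ∀ j → IsMVC (SRG j) (B j))
      (C : Fin k → Fin k → Pred U 0ℓ) (C-xvc : ∀ j i → i ≢ j → IsXVC (SRG i) (MDu i) (C j i)) where

    U₀ : Pred U 0ℓ
    U₀ = A₀ ∪ ⋃ (Fin k) B₀

    Uⱼ : Fin k → Pred U 0ℓ
    Uⱼ j x = A j x ⊎ B j x ⊎ Σ (Fin k) λ i → i ≢ j × C j i x

    A₀⊆HSide : A₀ ⊆ HSide
    A₀⊆HSide = cover-⊆V (mvc⇒vc A₀-mvc)

    B₀⊆GSide : ∀ i → B₀ i ⊆ GSide i
    B₀⊆GSide i = cover-⊆V (xvc⇒vc (B₀-xvc i))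

    A⊆HSide : ∀ j → A j ⊆ HSide
    A⊆HSide j = cover-⊆V (xvc⇒vc (A-xvc j))

    -- The part of Uⱼ j inside G i.
    Part : Fin k → Fin k → Pred U 0ℓ
    Part j i x = (i ≡ j × B j x) ⊎ (i ≢ j × C j i x)

    B⊆Part : ∀ j → B j ⊆ Part j j
    B⊆Part j x b = inj₁ (refl , b)

    Part⊆B : ∀ j → Part j j ⊆ B j
    Part⊆B j x (inj₁ (_ , b)) = b
    Part⊆B j x (inj₂ (j≢j , _)) = contradiction refl j≢j

    C⊆Part : ∀ {j i} → i ≢ j → C j i ⊆ Part j i
    C⊆Part i≢j x c = inj₂ (i≢j , c)

    Part⊆C : ∀ {j i} → i ≢ j → Part j i ⊆ C j i
    Part⊆C i≢j x (inj₁ (i≡j , _)) = contradiction i≡j i≢j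
    Part⊆C i≢j x (inj₂ (_ , c)) = c

    Part⊆GSide : ∀ j i → Part j i ⊆ GSide i
    Part⊆GSide j i x (inj₁ (refl , b)) = cover-⊆V (mvc⇒vc (B-mvc j)) x b
    Part⊆GSide j i x (inj₂ (i≢j , c)) = cover-⊆V (xvc⇒vc (C-xvc j i i≢j)) x c

    Uⱼ⊆ : ∀ j → Uⱼ j ⊆ (A j ∪ ⋃ (Fin k) (Part j))
    Uⱼ⊆ j x (inj₁ a) = inj₁ a
    Uⱼ⊆ j x (inj₂ (inj₁ b)) = inj₂ (j , B⊆Part j x b)
    Uⱼ⊆ j x (inj₂ (inj₂ (i , i≢j , c))) = inj₂ (i , C⊆Part i≢j x c)

    ⊆Uⱼ : ∀ j → (A j ∪ ⋃ (Fin k) (Part j)) ⊆ Uⱼ j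
    ⊆Uⱼ j x (inj₁ a) = inj₁ a
    ⊆Uⱼ j x (inj₂ (i , inj₁ (refl , b))) = inj₂ (inj₁ b)
    ⊆Uⱼ j x (inj₂ (i , inj₂ (i≢j , c))) = inj₂ (inj₂ (i , i≢j , c))

    U₀-cover : IsVC (SR J) U₀
    U₀-cover = U₀⊆V , covers
      where
      U₀⊆V : U₀ ⊆ V (SR J)
      U₀⊆V x (inj₁ a) = H⇒J (proj₁ (A₀⊆HSide x a))
      U₀⊆V x (inj₂ (i , b)) = GSide⇒J (B₀⊆GSide i x b)
      covers : ∀ x y → E (SR J) x y → U₀ x ⊎ U₀ y
      covers x y e with SR-J-edge-cases e
      ... | in-H e′ = ⊎-map inj₁ inj₁ (cover-edge (mvc⇒vc A₀-mvc) x y e′)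
      ... | in-G i e′ = ⊎-map (inj₂ ∘ (i ,_)) (inj₂ ∘ (i ,_)) (cover-edge (xvc⇒vc (B₀-xvc i)) x y e′)
      ... | crossˡ i x∈MD _ = inj₁ (inj₂ (i , xvc-⊇ (B₀-xvc i) x x∈MD))
      ... | crossʳ i y∈MD _ = inj₂ (inj₂ (i , xvc-⊇ (B₀-xvc i) y y∈MD))

    Uⱼ-cover : ∀ j → IsVC (SR J) (Uⱼ j)
    Uⱼ-cover j = (λ x → ⊆V x ∘ Uⱼ⊆ j x) , covers
      where
      ⊆V : (A j ∪ ⋃ (Fin k) (Part j)) ⊆ V (SR J)
      ⊆V x (inj₁ a) = H⇒J (proj₁ (A⊆HSide j x a))
      ⊆V x (inj₂ (i , p)) = GSide⇒J (Part⊆GSide j i x p)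
      inside : ∀ i {x y} → E (SRG i) x y → Uⱼ j x ⊎ Uⱼ j y
      inside i {x} {y} e with i ≟ᶠ j
      ... | yes refl = ⊎-map (inj₂ ∘ inj₁) (inj₂ ∘ inj₁) (cover-edge (mvc⇒vc (B-mvc j)) x y e)
      ... | no i≢j = ⊎-map (λ c → inj₂ (inj₂ (i , i≢j , c))) (λ c → inj₂ (inj₂ (i , i≢j , c)))
                           (cover-edge (xvc⇒vc (C-xvc j i i≢j)) x y e)
      cross : ∀ i {x y} → MDu i x → Facing i y → Uⱼ j x ⊎ Uⱼ j y
      cross i {x} {y} x∈MD y-facing with i ≟ᶠ j
      ... | no i≢j = inj₁ (inj₂ (inj₂ (i , i≢j , xvc-⊇ (C-xvc j i i≢j) x x∈MD)))
      cross i {x} {y} x∈MD (inj₁ y∈MDv) | yes refl = inj₂ (inj₁ (xvc-⊇ (A-xvc j) y y∈MDv))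
      cross i {x} {y} x∈MD (inj₂ (m , m≢j , y∈MD)) | yes refl =
        inj₂ (inj₂ (inj₂ (m , m≢j , xvc-⊇ (C-xvc j m m≢j) y y∈MD)))
      covers : ∀ x y → E (SR J) x y → Uⱼ j x ⊎ Uⱼ j y
      covers x y e with SR-J-edge-cases e
      ... | in-H e′ = ⊎-map inj₁ inj₁ (cover-edge (xvc⇒vc (A-xvc j)) x y e′)
      ... | in-G i e′ = inside i e′
      ... | crossˡ i x∈MD y-facing = cross i x∈MD y-facing
      ... | crossʳ i y∈MD x-facing = ⊎-swap (cross i y∈MD x-facing)

    a₀ : ℕ
    a₀ = proj₁ (mvc-size A₀-mvc)

    b₀ : Fin k → ℕ
    b₀ i = proj₁ (xvc-size (B₀-xvc i))

    a : Fin k → ℕ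
    a j = proj₁ (xvc-size (A-xvc j))

    A₀-size : HasSize A₀ a₀
    A₀-size = proj₂ (mvc-size A₀-mvc)

    B₀-size : ∀ i → HasSize (B₀ i) (b₀ i)
    B₀-size i = proj₂ (xvc-size (B₀-xvc i))

    A-size : ∀ j → HasSize (A j) (a j)
    A-size j = proj₂ (xvc-size (A-xvc j))

    part-size : ∀ j i → Σ ℕ (HasSize (Part j i))
    part-size j i with i ≟ᶠ j
    ... | yes refl = let n , B-n = mvc-size (B-mvc j) in n , size-cong (B⊆Part j) (Part⊆B j) B-n
    ... | no i≢j = let n , C-n = xvc-size (C-xvc j i i≢j) in n , size-cong (C⊆Part i≢j) (Part⊆C i≢j) C-n

    p : Fin k → Fin k → ℕ
    p j i = proj₁ (part-size j i)

    part-minimal : ∀ {j i S m} → IsVC (SRG i) S → (i ≢ j → MDu i ⊆ S) → HasSize S m → p j i ≤ m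
    part-minimal {j} {i} S-cover MD⊆S S-m with i ≟ᶠ j | proj₂ (part-size j i)
    ... | yes refl | Part-n = mvc-minimal (B-mvc j) (size-cong (Part⊆B j) (B⊆Part j) Part-n) S-cover S-m
    ... | no i≢j | Part-n = xvc-minimal (C-xvc j i i≢j) (size-cong (Part⊆C i≢j) (C⊆Part i≢j) Part-n) S-cover (MD⊆S i≢j) S-m

    U₀-size : HasSize U₀ (a₀ + sum b₀)
    U₀-size = size-∪ (λ x A₀x (i , B₀x) → H∉GSide (proj₁ (A₀⊆HSide x A₀x)) (B₀⊆GSide i x B₀x))
                     A₀-size
                     (size-⋃ (λ i j x B₀x B₀′x → G-index-unique (proj₁ (B₀⊆GSide i x B₀x)) (proj₁ (B₀⊆GSide j x B₀′x)))
                             B₀-size)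

    Uⱼ-size : ∀ j → HasSize (Uⱼ j) (a j + sum (p j))
    Uⱼ-size j = size-cong (⊆Uⱼ j) (Uⱼ⊆ j)
      (size-∪ (λ x Ax (i , Px) → H∉GSide (proj₁ (A⊆HSide j x Ax)) (Part⊆GSide j i x Px))
              (A-size j)
              (size-⋃ (λ i i′ x Px P′x → G-index-unique (proj₁ (Part⊆GSide j i x Px)) (proj₁ (Part⊆GSide j i′ x P′x)))
                      (λ i → proj₂ (part-size j i))))

    candidate : Fin (suc k) → Pred U 0ℓ
    candidate zero = U₀
    candidate (suc j) = Uⱼ j

    candidate-size : Fin (suc k) → ℕ
    candidate-size zero = a₀ + sum b₀
    candidate-size (suc j) = a j + sum (p j)

    candidate-cover : ∀ c → IsVC (SR J) (candidate c)
    candidate-cover zero = U₀-cover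
    candidate-cover (suc j) = Uⱼ-cover j

    candidate-hasSize : ∀ c → HasSize (candidate c) (candidate-size c)
    candidate-hasSize zero = U₀-size
    candidate-hasSize (suc j) = Uⱼ-size j

    module Dominance {S : Pred U 0ℓ} {m : ℕ} (S-cover : IsVC (SR J) S) (S-m : HasSize S m) where

      h : ℕ
      h = proj₁ (size-∩ HSide? S-m)

      s : Fin k → ℕ
      s i = proj₁ (size-∩ (GSide? i) S-m)

      S∩HSide-size : HasSize (S ∩ HSide) h
      S∩HSide-size = proj₂ (size-∩ HSide? S-m)

      S∩GSide-size : ∀ i → HasSize (S ∩ GSide i) (s i)
      S∩GSide-size i = proj₂ (size-∩ (GSide? i) S-m)

      parts-≤ : h + sum s ≤ m
      parts-≤ = size-mono (λ x → [ proj₁ , proj₁ ∘ proj₂ ])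
        (size-∪ (λ x (_ , x∈H) (i , _ , x∈G) → H∉GSide (proj₁ x∈H) x∈G) (S∩HSide-size)
                (size-⋃ (λ i j x (_ , x∈Gi) (_ , x∈Gj) → G-index-unique (proj₁ x∈Gi) (proj₁ x∈Gj))
                        S∩GSide-size))
        S-m

      H-cover : IsVC SRH (S ∩ HSide)
      H-cover = cover-restrict SRH⇒SR-J SRH-E-in-V S-cover

      G-cover : ∀ i → IsVC (SRG i) (S ∩ GSide i)
      G-cover i = cover-restrict SRG⇒SR-J SRG-E-in-V S-cover

      S? : Decidable S
      S? = HasSize⇒Decidable _≟_ S-m

      module Missing {j} (MDu⊈S : ¬ (MDu j ⊆ S)) where

        MDv⊆S : MDv j ⊆ S
        MDv⊆S y y∈ = cover-common-neighbour S-cover S? MDu⊈S (λ x x∈ → MDu-MDv⇒SR-J x∈ y∈)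

        MDu⊆S : ∀ {i} → i ≢ j → MDu i ⊆ S
        MDu⊆S i≢j y y∈ = cover-common-neighbour S-cover S? MDu⊈S (λ x x∈ → MDu-MDu⇒SR-J (i≢j ∘ sym) x∈ y∈)

        Uⱼ-≤ : a j + sum (p j) ≤ m
        Uⱼ-≤ = ≤-trans
          (+-mono-≤ (xvc-minimal (A-xvc j) (A-size j) H-cover
                                 (λ y y∈ → MDv⊆S y y∈ , proj₁ (proj₁ y∈) , proj₂ y∈) (S∩HSide-size))
                    (sum-mono-≤ λ i → part-minimal (G-cover i) (λ i≢j y y∈ → MDu⊆S i≢j y y∈ , MDu⇒GSide y∈)
                                                   (S∩GSide-size i)))
          parts-≤

      dominated : Σ (Fin (suc k)) λ c → candidate-size c ≤ m
      dominated with all? (λ i → b₀ i ≤? s i)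
      ... | yes b₀≤s = zero , ≤-trans (+-mono-≤ a₀≤h (sum-mono-≤ b₀≤s)) parts-≤
        where
        a₀≤h : a₀ ≤ h
        a₀≤h = mvc-minimal A₀-mvc A₀-size H-cover (S∩HSide-size)
      ... | no b₀≰s =
        let j , b₀ⱼ≰sⱼ = ¬∀⟶∃¬ k _ (λ i → b₀ i ≤? s i) b₀≰s in suc j , Missing.Uⱼ-≤ (MDu⊈S j b₀ⱼ≰sⱼ)
        where
        MDu⊈S : ∀ j → ¬ b₀ j ≤ s j → ¬ (MDu j ⊆ S)
        MDu⊈S j b₀ⱼ≰sⱼ MDu⊆S = b₀ⱼ≰sⱼ (xvc-minimal (B₀-xvc j) (B₀-size j) (G-cover j)
                                         (λ x x∈ → MDu⊆S x x∈ , MDu⇒GSide x∈) (S∩GSide-size j))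

    some-candidate-minimum : Σ (Fin (suc k)) λ c → IsMVC (SR J) (candidate c)
    some-candidate-minimum = mvc-among candidate candidate-size candidate-cover candidate-hasSize
      (λ S m S-cover S-m → Dominance.dominated S-cover S-m)

lemma7 : {U : Set} → DecidableEquality U →
  (k : ℕ) → 1 ≤ k →
  (G : Fin k → Graph U) (H : Graph U) →
  (∀ i → IsFiniteSimpleGraph (G i)) → IsFiniteSimpleGraph H →
  (∀ i → Connected (G i)) → Connected H →
  (∀ i → AtLeastTwoVertices (G i)) → AtLeastTwoVertices H →
  (∀ i j → i ≢ j → ∀ x → V (G i) x → ¬ V (G j) x) →
  (∀ i x → V (G i) x → ¬ V H x) →
  (u v : Fin k → U) →
  (∀ i → V (G i) (u i)) → (∀ i → V H (v i)) →
  let J = compose k G H u v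
      Vs = λ x → Σ (Fin k) λ i → x ≡ v i
      SRH = SR H ∖ Vs
      SRG = λ i → SR (G i) ∖ (λ x → x ≡ u i)
  in
  -- choices for U₀
  (A₀ : U → Set) → IsMVC SRH A₀ →
  (B₀ : Fin k → U → Set) → (∀ i → IsXVC (SRG i) (MD (G i) (u i)) (B₀ i)) →
  -- choices for U_j
  (A : Fin k → U → Set) →
  (∀ j → IsXVC SRH (λ x → MD H (v j) x × ¬ Vs x) (A j)) →
  (B : Fin k → U → Set) → (∀ j → IsMVC (SRG j) (B j)) →
  (C : Fin k → Fin k → U → Set) →
  (∀ j i → i ≢ j → IsXVC (SRG i) (MD (G i) (u i)) (C j i)) →
  let U₀ = λ x → A₀ x ⊎ Σ (Fin k) λ i → B₀ i x
      Uj = λ j x → A j x ⊎ B j x ⊎ Σ (Fin k) λ i → i ≢ j × C j i x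
  in
  (IsVC (SR J) U₀ × (∀ j → IsVC (SR J) (Uj j))) ×
  (IsMVC (SR J) U₀ ⊎ Σ (Fin k) λ j → IsMVC (SR J) (Uj j))
lemma7 _≟_ k _ G H G-finite H-finite G-connected H-connected G-two H-two G-disjoint GH-disjoint u v u∈G v∈H
       A₀ A₀-mvc B₀ B₀-xvc A A-xvc B B-mvc C C-xvc =
  (U₀-cover , Uⱼ-cover) , minimum some-candidate-minimum
  where
  open Composition _≟_ k G H G-finite H-finite G-connected H-connected G-two H-two G-disjoint GH-disjoint u v u∈G v∈H
  open Candidates A₀ A₀-mvc B₀ B₀-xvc A A-xvc B B-mvc C C-xvc
  minimum : Σ (Fin (suc k)) (λ c → IsMVC (SR J) (candidate c)) → IsMVC (SR J) U₀ ⊎ Σ (Fin k) λ j → IsMVC (SR J) (Uⱼ j)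
  minimum (zero , U₀-mvc) = inj₁ U₀-mvc
  minimum (suc j , Uⱼ-mvc) = inj₂ (j , Uⱼ-mvc)
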